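{- Let $M$ be a matroid of rank $r$ on a ground set of $n$ elements, with Tutte polynomial $T(M;x,y)=\sum_{i,j}b_{i,j}x^iy^j$. Then $$\sum_{i=0}^n\sum_{j=0}^{n-i}(-1)^j\binom{n-i}{j}b_{i,j}=(-1)^{n-r}.$$
   Context: The Tutte polynomial of a matroid $M$ on ground set $S$ with rank function $r$ is $T(M;x,y)=\sum_{A\subseteq S}(x-1)^{r(S)-r(A)}(y-1)^{|A|-r(A)}$, and $b_{i,j}$ is its coefficient of $x^iy^j$. -}

module Defs where

open import Data.Nat as ℕ using (ℕ; zero; suc; _∸_) renaming (_≤_ to _≤ℕ_; _+_ to _+ℕ_)
open import Data.Nat.Combinatorics using (_C_)
open import Data.Integer using (ℤ; +_; -_; _*_; _+_)
open import Data.List using (List; []; _∷_; map; _++_; concatMap)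
open import Data.Vec using (Vec; []; _∷_)
open import Data.Bool using (true; false)
open import Data.Fin.Subset using (Subset; _⊆_; _∪_; _∩_; ∣_∣; ⊤)

-- A matroid on the ground set Fin n, given by its rank function
-- (rank axioms R1–R3 plus normalisation r(∅) = 0 follows from R1).
record Matroid (n : ℕ) : Set where
  field
    rk        : Subset n → ℕ
    rk-bound  : ∀ A → rk A ≤ℕ ∣ A ∣
    rk-mono   : ∀ A B → A ⊆ B → rk A ≤ℕ rk B
    rk-submod : ∀ A B → rk (A ∪ B) +ℕ rk (A ∩ B) ≤ℕ rk A +ℕ rk B

open Matroid public

rank : ∀ {n} → Matroid n → ℕ
rank M = rk M ⊤

allSubsets : (n : ℕ) → List (Subset n)
allSubsets zero    = [] ∷ []
allSubsets (suc n) = map (false ∷_) (allSubsets n) ++ map (true ∷_) (allSubsets n)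

sgn : ℕ → ℤ
sgn zero    = + 1
sgn (suc k) = - sgn k

sumℤ : List ℤ → ℤ
sumℤ []       = + 0
sumℤ (x ∷ xs) = x + sumℤ xs

sumTo : ℕ → (ℕ → ℤ) → ℤ
sumTo zero    f = f 0
sumTo (suc m) f = sumTo m f + f (suc m)

-- coefficient of t^i in (t - 1)^a, i.e. C(a,i) (-1)^(a-i)  (zero when i > a)
coeffPow : ℕ → ℕ → ℤ
coeffPow a i = sgn (a ∸ i) * + (a C i)

-- b_{i,j}: coefficient of x^i y^j in
-- T(M;x,y) = Σ_{A ⊆ S} (x-1)^(r(S)-r(A)) (y-1)^(|A|-r(A))
tutteCoeff : ∀ {n} → Matroid n → ℕ → ℕ → ℤ
tutteCoeff {n} M i j =
  sumℤ (map (λ A → coeffPow (rank M ∸ rk M A) i * coeffPow (∣ A ∣ ∸ rk M A) j)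
            (allSubsets n))

{-# OPTIONS --safe #-}
-- Expanding b_{i,j} subset by subset, the contribution of A ⊆ S with a = r - r(A) and
-- b = |A| - r(A) is Σ_i Σ_j (-1)^j C(n-i,j) [x^i](x-1)^a [y^j](y-1)^b. By Vandermonde the
-- j-sum is (-1)^b C(n-i+b,b), and the i-sum is then an a-th finite difference of a binomial
-- coefficient, (-1)^(a+b) C(n-a+b,n) = (-1)^(r+|A|) C(n-r+|A|,n). Grouping subsets by size,
-- Σ_t C(n,t) (-1)^t C(n-r+t,n) is the n-th finite difference of C(·,n), namely (-1)^n.
module Submission where

open import Defs
open import Data.Nat using (ℕ; _∸_)
open import Data.Nat.Combinatorics using (_C_)
open import Data.Integer using (ℤ; +_; _*_)
open import Relation.Binary.PropositionalEquality using (_≡_)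

import Algebra.Properties.CommutativeSemigroup as CommutativeSemigroupProperties
open import Data.Fin.Subset using (Subset; ∣_∣; ⊤)
open import Data.Fin.Subset.Properties using (∣⊤∣≡n; ⊆⊤)
open import Data.Integer using (-_; _+_)
import Data.Integer.Properties as ℤ
open import Data.Integer.Tactic.RingSolver using (solve-∀)
open import Data.List using (List; []; _∷_; map; _++_)
open import Data.List.Properties using (map-++; map-∘; map-cong)
open import Data.Nat using (zero; suc; _≤_; _<_; z≤n; s≤s; _≤?_) renaming (_+_ to _+ℕ_)
open import Data.Nat.Combinatorics
  using (nCk+nC[k+1]≡[n+1]C[k+1]; k>n⇒nCk≡0; nCk≡nC[n∸k]; nCn≡1)
import Data.Nat.Properties as ℕ
open import Data.Sum using (inj₁; inj₂)
import Data.Vec as Vec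
open import Data.Bool using (true; false)
open import Relation.Nullary using (yes; no)
open import Relation.Binary.PropositionalEquality
  using (refl; sym; trans; cong; cong₂; subst; module ≡-Reasoning)
open ≡-Reasoning

private
  module ℕ+ = CommutativeSemigroupProperties ℕ.+-commutativeSemigroup
  module ℤ+ = CommutativeSemigroupProperties ℤ.+-commutativeSemigroup
  module ℤ* = CommutativeSemigroupProperties ℤ.*-commutativeSemigroup

m∸[n∸o]≡m∸n+o : ∀ {m n o} → o ≤ n → n ≤ m → m ∸ (n ∸ o) ≡ m ∸ n +ℕ o
m∸[n∸o]≡m∸n+o {m} {n} {o} o≤n n≤m = begin
  m ∸ (n ∸ o)                       ≡⟨ cong (_∸ (n ∸ o)) split ⟨
  m ∸ n +ℕ o +ℕ (n ∸ o) ∸ (n ∸ o)  ≡⟨ ℕ.m+n∸n≡m (m ∸ n +ℕ o) (n ∸ o) ⟩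
  m ∸ n +ℕ o                        ∎
  where
  split : m ∸ n +ℕ o +ℕ (n ∸ o) ≡ m
  split = trans (ℕ.+-assoc (m ∸ n) o (n ∸ o))
                (trans (cong (m ∸ n +ℕ_) (ℕ.m+[n∸m]≡n o≤n)) (ℕ.m∸n+n≡m n≤m))

C-complement : ∀ {n k e} → n ≡ k +ℕ e → n C k ≡ n C e
C-complement {k = k} {e} refl =
  trans (nCk≡nC[n∸k] (ℕ.m≤m+n k e)) (cong ((k +ℕ e) C_) (ℕ.m+n∸m≡n k e))

sgn-+ : ∀ m n → sgn (m +ℕ n) ≡ sgn m * sgn n
sgn-+ zero    n = sym (ℤ.*-identityˡ (sgn n))
sgn-+ (suc m) n = trans (cong -_ (sgn-+ m n)) (ℤ.neg-distribˡ-* (sgn m) (sgn n))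

sgn-*-sgn : ∀ n → sgn n * sgn n ≡ + 1
sgn-*-sgn zero    = refl
sgn-*-sgn (suc n) = trans (neg-*-neg (sgn n)) (sgn-*-sgn n)
  where
  neg-*-neg : ∀ x → - x * - x ≡ x * x
  neg-*-neg = solve-∀

sgn-∸ : ∀ {m n} → n ≤ m → sgn (m ∸ n) ≡ sgn n * sgn m
sgn-∸ {m} {n} n≤m = begin
  sgn (m ∸ n)                        ≡⟨ ℤ.*-identityˡ (sgn (m ∸ n)) ⟨
  + 1 * sgn (m ∸ n)                  ≡⟨ cong (_* sgn (m ∸ n)) (sgn-*-sgn n) ⟨
  sgn n * sgn n * sgn (m ∸ n)        ≡⟨ ℤ.*-assoc (sgn n) (sgn n) (sgn (m ∸ n)) ⟩
  sgn n * (sgn n * sgn (m ∸ n))      ≡⟨ cong (sgn n *_) (sgn-+ n (m ∸ n)) ⟨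
  sgn n * sgn (n +ℕ (m ∸ n))         ≡⟨ cong (λ k → sgn n * sgn k) (ℕ.m+[n∸m]≡n n≤m) ⟩
  sgn n * sgn m                      ∎

sumTo-cong : ∀ m {f g : ℕ → ℤ} → (∀ {k} → k ≤ m → f k ≡ g k) → sumTo m f ≡ sumTo m g
sumTo-cong zero    f≗g = f≗g z≤n
sumTo-cong (suc m) f≗g =
  cong₂ _+_ (sumTo-cong m (λ k≤m → f≗g (ℕ.m≤n⇒m≤1+n k≤m))) (f≗g ℕ.≤-refl)

sumTo-zero : ∀ m → sumTo m (λ _ → + 0) ≡ + 0
sumTo-zero zero    = refl
sumTo-zero (suc m) = cong (_+ + 0) (sumTo-zero m)

sumTo-suc : ∀ m (f : ℕ → ℤ) → sumTo (suc m) f ≡ f 0 + sumTo m (λ k → f (suc k))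
sumTo-suc zero    f = refl
sumTo-suc (suc m) f = trans (cong (_+ f (2 +ℕ m)) (sumTo-suc m f)) (ℤ.+-assoc (f 0) _ _)

sumTo-+ : ∀ m (f g : ℕ → ℤ) → sumTo m (λ k → f k + g k) ≡ sumTo m f + sumTo m g
sumTo-+ zero    f g = refl
sumTo-+ (suc m) f g =
  trans (cong (_+ (f (suc m) + g (suc m))) (sumTo-+ m f g))
        (ℤ+.interchange (sumTo m f) (sumTo m g) (f (suc m)) (g (suc m)))

sumTo-neg : ∀ m (f : ℕ → ℤ) → sumTo m (λ k → - f k) ≡ - sumTo m f
sumTo-neg zero    f = refl
sumTo-neg (suc m) f =
  trans (cong (_+ - f (suc m)) (sumTo-neg m f)) (sym (ℤ.neg-distrib-+ (sumTo m f) (f (suc m))))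

*-distribˡ-sumTo : ∀ m c (f : ℕ → ℤ) → c * sumTo m f ≡ sumTo m (λ k → c * f k)
*-distribˡ-sumTo zero    c f = refl
*-distribˡ-sumTo (suc m) c f =
  trans (ℤ.*-distribˡ-+ c (sumTo m f) (f (suc m))) (cong (_+ c * f (suc m)) (*-distribˡ-sumTo m c f))

sumTo-reverse : ∀ m (f : ℕ → ℤ) → sumTo m f ≡ sumTo m (λ k → f (m ∸ k))
sumTo-reverse zero    f = refl
sumTo-reverse (suc m) f = begin
  sumTo m f + f (suc m)                      ≡⟨ cong (_+ f (suc m)) (sumTo-reverse m f) ⟩
  sumTo m (λ k → f (m ∸ k)) + f (suc m)      ≡⟨ ℤ.+-comm _ (f (suc m)) ⟩
  f (suc m) + sumTo m (λ k → f (m ∸ k))      ≡⟨ sumTo-suc m (λ k → f (suc m ∸ k)) ⟨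
  sumTo (suc m) (λ k → f (suc m ∸ k))        ∎

sumTo-truncate : ∀ {a m} {f : ℕ → ℤ} → a ≤ m → (∀ {k} → a < k → f k ≡ + 0) →
                 sumTo m f ≡ sumTo a f
sumTo-truncate {m = zero} z≤n _ = refl
sumTo-truncate {a} {suc m} {f} a≤1+m f≡0 with ℕ.m≤n⇒m<n∨m≡n a≤1+m
... | inj₂ refl = refl
... | inj₁ (s≤s a≤m) = begin
  sumTo m f + f (suc m)  ≡⟨ cong₂ _+_ (sumTo-truncate a≤m f≡0) (f≡0 (s≤s a≤m)) ⟩
  sumTo a f + + 0        ≡⟨ ℤ.+-identityʳ (sumTo a f) ⟩
  sumTo a f              ∎

sumℤ-++ : (xs ys : List ℤ) → sumℤ (xs ++ ys) ≡ sumℤ xs + sumℤ ys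
sumℤ-++ []       ys = sym (ℤ.+-identityˡ (sumℤ ys))
sumℤ-++ (x ∷ xs) ys = trans (cong (_+_ x) (sumℤ-++ xs ys)) (sym (ℤ.+-assoc x _ _))

module _ {X : Set} where

  *-distribˡ-sumℤ : ∀ c (f : X → ℤ) xs → c * sumℤ (map f xs) ≡ sumℤ (map (λ x → c * f x) xs)
  *-distribˡ-sumℤ c f []       = ℤ.*-zeroʳ c
  *-distribˡ-sumℤ c f (x ∷ xs) =
    trans (ℤ.*-distribˡ-+ c (f x) _) (cong (_+_ (c * f x)) (*-distribˡ-sumℤ c f xs))

  sumTo-sumℤ : ∀ m (g : ℕ → X → ℤ) xs →
    sumTo m (λ k → sumℤ (map (g k) xs)) ≡ sumℤ (map (λ x → sumTo m (λ k → g k x)) xs)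
  sumTo-sumℤ m g []       = sumTo-zero m
  sumTo-sumℤ m g (x ∷ xs) =
    trans (sumTo-+ m (λ k → g k x) (λ k → sumℤ (map (g k) xs)))
          (cong (_+_ (sumTo m (λ k → g k x))) (sumTo-sumℤ m g xs))

  sumTo-sumTo-sumℤ : ∀ n (m : ℕ → ℕ) (c : ℕ → ℕ → ℤ) (g : ℕ → ℕ → X → ℤ) xs →
    sumTo n (λ i → sumTo (m i) (λ j → c i j * sumℤ (map (g i j) xs)))
      ≡ sumℤ (map (λ x → sumTo n (λ i → sumTo (m i) (λ j → c i j * g i j x))) xs)
  sumTo-sumTo-sumℤ n m c g xs = begin
    sumTo n (λ i → sumTo (m i) (λ j → c i j * sumℤ (map (g i j) xs)))
      ≡⟨ sumTo-cong n (λ {i} _ → inner i) ⟩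
    sumTo n (λ i → sumℤ (map (λ x → sumTo (m i) (λ j → c i j * g i j x)) xs))
      ≡⟨ sumTo-sumℤ n (λ i x → sumTo (m i) (λ j → c i j * g i j x)) xs ⟩
    sumℤ (map (λ x → sumTo n (λ i → sumTo (m i) (λ j → c i j * g i j x))) xs) ∎
    where
    inner : ∀ i → sumTo (m i) (λ j → c i j * sumℤ (map (g i j) xs))
                  ≡ sumℤ (map (λ x → sumTo (m i) (λ j → c i j * g i j x)) xs)
    inner i = trans (sumTo-cong (m i) (λ {j} _ → *-distribˡ-sumℤ (c i j) (g i j) xs))
                    (sumTo-sumℤ (m i) (λ j x → c i j * g i j x) xs)

sumTo-binomial-suc : ∀ n (f : ℕ → ℤ) →
  sumTo (suc n) (λ k → + (suc n C k) * f k)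
    ≡ sumTo n (λ k → + (n C k) * f k) + sumTo n (λ k → + (n C k) * f (suc k))
sumTo-binomial-suc n f = begin
  sumTo (suc n) (λ k → + (suc n C k) * f k)
    ≡⟨ sumTo-suc n _ ⟩
  f₀ + sumTo n (λ k → + (suc n C suc k) * f (suc k))
    ≡⟨ cong (_+_ f₀) (trans (sumTo-cong n (λ {k} _ → pascal k)) (sumTo-+ n _ _)) ⟩
  f₀ + (shifted + upper)
    ≡⟨ ℤ+.x∙yz≈y∙xz f₀ shifted upper ⟩
  shifted + (f₀ + upper)
    ≡⟨ cong (_+_ shifted) (sumTo-suc n (λ k → + (n C k) * f k)) ⟨
  shifted + sumTo (suc n) (λ k → + (n C k) * f k)
    ≡⟨ cong (_+_ shifted) top-vanishes ⟩
  shifted + sumTo n (λ k → + (n C k) * f k)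
    ≡⟨ ℤ.+-comm shifted _ ⟩
  sumTo n (λ k → + (n C k) * f k) + shifted ∎
  where
  f₀ shifted upper : ℤ
  f₀      = + 1 * f 0
  shifted = sumTo n (λ k → + (n C k) * f (suc k))
  upper   = sumTo n (λ k → + (n C suc k) * f (suc k))
  pascal : ∀ k → + (suc n C suc k) * f (suc k) ≡ + (n C k) * f (suc k) + + (n C suc k) * f (suc k)
  pascal k = begin
    + (suc n C suc k) * f (suc k)
      ≡⟨ cong (λ c → + c * f (suc k)) (nCk+nC[k+1]≡[n+1]C[k+1] n k) ⟨
    + (n C k +ℕ n C suc k) * f (suc k)
      ≡⟨ cong (_* f (suc k)) (ℤ.pos-+ (n C k) (n C suc k)) ⟩
    (+ (n C k) + + (n C suc k)) * f (suc k)
      ≡⟨ ℤ.*-distribʳ-+ (f (suc k)) (+ (n C k)) (+ (n C suc k)) ⟩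
    + (n C k) * f (suc k) + + (n C suc k) * f (suc k) ∎
  top-vanishes : sumTo (suc n) (λ k → + (n C k) * f k) ≡ sumTo n (λ k → + (n C k) * f k)
  top-vanishes = trans (cong (λ c → sumTo n (λ k → + (n C k) * f k) + + c * f (suc n))
                             (k>n⇒nCk≡0 (ℕ.n<1+n n)))
                       (ℤ.+-identityʳ _)

vandermonde : ∀ m b t → sumTo m (λ j → + (m C j) * + (b C (t +ℕ j))) ≡ + ((m +ℕ b) C (t +ℕ m))
vandermonde zero    b t = ℤ.*-identityˡ _
vandermonde (suc m) b t = begin
  sumTo (suc m) (λ j → + (suc m C j) * + (b C (t +ℕ j)))
    ≡⟨ sumTo-binomial-suc m (λ j → + (b C (t +ℕ j))) ⟩
  sumTo m (λ j → + (m C j) * + (b C (t +ℕ j))) + sumTo m (λ j → + (m C j) * + (b C (t +ℕ suc j)))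
    ≡⟨ cong₂ _+_ (vandermonde m b t)
                 (trans (sumTo-cong m (λ {j} _ → cong (λ k → + (m C j) * + (b C k)) (ℕ.+-suc t j)))
                        (vandermonde m b (suc t))) ⟩
  + ((m +ℕ b) C (t +ℕ m)) + + ((m +ℕ b) C suc (t +ℕ m))
    ≡⟨ ℤ.pos-+ ((m +ℕ b) C (t +ℕ m)) _ ⟨
  + ((m +ℕ b) C (t +ℕ m) +ℕ (m +ℕ b) C suc (t +ℕ m))
    ≡⟨ cong +_ (nCk+nC[k+1]≡[n+1]C[k+1] (m +ℕ b) (t +ℕ m)) ⟩
  + (suc (m +ℕ b) C suc (t +ℕ m))
    ≡⟨ cong (λ k → + (suc (m +ℕ b) C k)) (ℕ.+-suc t m) ⟨
  + ((suc m +ℕ b) C (t +ℕ suc m)) ∎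

sumTo-alternating-suc : ∀ a {g h : ℕ → ℤ} → (∀ k → g (suc k) ≡ h k + g k) →
  sumTo (suc a) (λ k → + (suc a C k) * (sgn k * g k))
    ≡ - sumTo a (λ k → + (a C k) * (sgn k * h k))
sumTo-alternating-suc a {g} {h} Δg≡h = begin
  sumTo (suc a) (λ k → + (suc a C k) * (sgn k * g k))
    ≡⟨ sumTo-binomial-suc a (λ k → sgn k * g k) ⟩
  sumTo a (λ k → + (a C k) * (sgn k * g k)) + sumTo a (λ k → + (a C k) * (- sgn k * g (suc k)))
    ≡⟨ sumTo-+ a _ _ ⟨
  sumTo a (λ k → + (a C k) * (sgn k * g k) + + (a C k) * (- sgn k * g (suc k)))
    ≡⟨ sumTo-cong a (λ {k} _ → step k) ⟩
  sumTo a (λ k → - (+ (a C k) * (sgn k * h k)))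
    ≡⟨ sumTo-neg a _ ⟩
  - sumTo a (λ k → + (a C k) * (sgn k * h k)) ∎
  where
  telescope : ∀ c s x y → c * (s * x) + c * (- s * (y + x)) ≡ - (c * (s * y))
  telescope = solve-∀
  step : ∀ k → + (a C k) * (sgn k * g k) + + (a C k) * (- sgn k * g (suc k))
               ≡ - (+ (a C k) * (sgn k * h k))
  step k rewrite Δg≡h k = telescope (+ (a C k)) (sgn k) (g k) (h k)

-- e stands for p + a - b; the equation avoids truncated subtraction.
sumTo-alternating-binomial : ∀ a p b e → p +ℕ a ≡ b +ℕ e →
  sumTo a (λ k → + (a C k) * (sgn k * + ((k +ℕ p) C b))) ≡ sgn a * + (p C e)
sumTo-alternating-binomial zero p b e p+0≡b+e = begin
  + 1 * (+ 1 * + (p C b))  ≡⟨ trans (ℤ.*-identityˡ _) (ℤ.*-identityˡ _) ⟩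
  + (p C b)                ≡⟨ cong +_ (C-complement {k = b} (trans (sym (ℕ.+-identityʳ p)) p+0≡b+e)) ⟩
  + (p C e)                ≡⟨ ℤ.*-identityˡ _ ⟨
  + 1 * + (p C e)          ∎
sumTo-alternating-binomial (suc a) p zero e p+1+a≡e = begin
  sumTo (suc a) (λ k → + (suc a C k) * (sgn k * + 1))
    ≡⟨ sumTo-alternating-suc a (λ _ → refl) ⟩
  - sumTo a (λ k → + (a C k) * (sgn k * + 0))
    ≡⟨ cong -_ (trans (sumTo-cong a (λ {k} _ → vanish k)) (sumTo-zero a)) ⟩
  + 0
    ≡⟨ ℤ.*-zeroʳ (sgn (suc a)) ⟨
  sgn (suc a) * + 0
    ≡⟨ cong (λ c → sgn (suc a) * + c) (k>n⇒nCk≡0 p<e) ⟨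
  sgn (suc a) * + (p C e) ∎
  where
  vanish : ∀ k → + (a C k) * (sgn k * + 0) ≡ + 0
  vanish k = trans (cong (+ (a C k) *_) (ℤ.*-zeroʳ (sgn k))) (ℤ.*-zeroʳ (+ (a C k)))
  p<e : p < e
  p<e = subst (p <_) p+1+a≡e (ℕ.m<m+n p (s≤s z≤n))
sumTo-alternating-binomial (suc a) p (suc b) e p+1+a≡1+b+e = begin
  sumTo (suc a) (λ k → + (suc a C k) * (sgn k * + ((k +ℕ p) C suc b)))
    ≡⟨ sumTo-alternating-suc a pascal ⟩
  - sumTo a (λ k → + (a C k) * (sgn k * + ((k +ℕ p) C b)))
    ≡⟨ cong -_ (sumTo-alternating-binomial a p b e p+a≡b+e) ⟩
  - (sgn a * + (p C e))
    ≡⟨ ℤ.neg-distribˡ-* (sgn a) (+ (p C e)) ⟩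
  sgn (suc a) * + (p C e) ∎
  where
  p+a≡b+e : p +ℕ a ≡ b +ℕ e
  p+a≡b+e = ℕ.suc-injective (trans (sym (ℕ.+-suc p a)) p+1+a≡1+b+e)
  pascal : ∀ k → + (suc (k +ℕ p) C suc b) ≡ + ((k +ℕ p) C b) + + ((k +ℕ p) C suc b)
  pascal k = trans (cong +_ (sym (nCk+nC[k+1]≡[n+1]C[k+1] (k +ℕ p) b)))
                   (ℤ.pos-+ ((k +ℕ p) C b) ((k +ℕ p) C suc b))

coeffPow-vanishes : ∀ {a i} → a < i → coeffPow a i ≡ + 0
coeffPow-vanishes {a} {i} a<i =
  trans (cong (λ c → sgn (a ∸ i) * + c) (k>n⇒nCk≡0 a<i)) (ℤ.*-zeroʳ (sgn (a ∸ i)))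

coeffPow-reverse : ∀ {a k} → k ≤ a → coeffPow a (a ∸ k) ≡ sgn k * + (a C k)
coeffPow-reverse {a} {k} k≤a =
  cong₂ (λ s c → sgn s * + c) (ℕ.m∸[m∸n]≡n k≤a) (sym (nCk≡nC[n∸k] k≤a))

sgn-*-coeffPow : ∀ j b → sgn j * coeffPow b j ≡ sgn b * + (b C j)
sgn-*-coeffPow j b with j ≤? b
... | yes j≤b = begin
  sgn j * (sgn (b ∸ j) * + (b C j))  ≡⟨ ℤ.*-assoc (sgn j) _ _ ⟨
  sgn j * sgn (b ∸ j) * + (b C j)    ≡⟨ cong (_* + (b C j)) (sgn-+ j (b ∸ j)) ⟨
  sgn (j +ℕ (b ∸ j)) * + (b C j)     ≡⟨ cong (λ k → sgn k * + (b C j)) (ℕ.m+[n∸m]≡n j≤b) ⟩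
  sgn b * + (b C j)                  ∎
... | no j≰b = begin
  sgn j * coeffPow b j  ≡⟨ cong (sgn j *_) (coeffPow-vanishes b<j) ⟩
  sgn j * + 0           ≡⟨ ℤ.*-zeroʳ (sgn j) ⟩
  + 0                   ≡⟨ ℤ.*-zeroʳ (sgn b) ⟨
  sgn b * + 0           ≡⟨ cong (λ c → sgn b * + c) (k>n⇒nCk≡0 b<j) ⟨
  sgn b * + (b C j)     ∎
  where
  b<j : b < j
  b<j = ℕ.≰⇒> j≰b

sumTo-alternating-coeffPow : ∀ m b →
  sumTo m (λ j → sgn j * + (m C j) * coeffPow b j) ≡ sgn b * + ((m +ℕ b) C b)
sumTo-alternating-coeffPow m b = begin
  sumTo m (λ j → sgn j * + (m C j) * coeffPow b j)
    ≡⟨ sumTo-cong m (λ {j} _ → term j) ⟩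
  sumTo m (λ j → sgn b * (+ (m C j) * + (b C j)))
    ≡⟨ *-distribˡ-sumTo m (sgn b) _ ⟨
  sgn b * sumTo m (λ j → + (m C j) * + (b C j))
    ≡⟨ cong (sgn b *_) (vandermonde m b 0) ⟩
  sgn b * + ((m +ℕ b) C m)
    ≡⟨ cong (λ c → sgn b * + c) (C-complement {k = m} refl) ⟩
  sgn b * + ((m +ℕ b) C b) ∎
  where
  term : ∀ j → sgn j * + (m C j) * coeffPow b j ≡ sgn b * (+ (m C j) * + (b C j))
  term j = begin
    sgn j * + (m C j) * coeffPow b j    ≡⟨ ℤ*.xy∙z≈y∙xz (sgn j) _ _ ⟩
    + (m C j) * (sgn j * coeffPow b j)  ≡⟨ cong (+ (m C j) *_) (sgn-*-coeffPow j b) ⟩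
    + (m C j) * (sgn b * + (b C j))     ≡⟨ ℤ*.x∙yz≈y∙xz (+ (m C j)) (sgn b) (+ (b C j)) ⟩
    sgn b * (+ (m C j) * + (b C j))     ∎

sumTo-coeffPow-binomial : ∀ n a b → a ≤ n →
  sumTo n (λ i → coeffPow a i * + ((n ∸ i +ℕ b) C b)) ≡ sgn a * + ((n ∸ a +ℕ b) C n)
sumTo-coeffPow-binomial n a b a≤n = begin
  sumTo n f
    ≡⟨ sumTo-truncate a≤n (λ {i} a<i → cong (_* + ((n ∸ i +ℕ b) C b)) (coeffPow-vanishes a<i)) ⟩
  sumTo a f
    ≡⟨ sumTo-reverse a f ⟩
  sumTo a (λ k → f (a ∸ k))
    ≡⟨ sumTo-cong a reindex ⟩
  sumTo a (λ k → + (a C k) * (sgn k * + ((k +ℕ (n ∸ a +ℕ b)) C b)))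
    ≡⟨ sumTo-alternating-binomial a (n ∸ a +ℕ b) b n
         (trans (ℕ+.xy∙z≈y∙zx (n ∸ a) b a) (cong (b +ℕ_) (ℕ.m+[n∸m]≡n a≤n))) ⟩
  sgn a * + ((n ∸ a +ℕ b) C n) ∎
  where
  f : ℕ → ℤ
  f i = coeffPow a i * + ((n ∸ i +ℕ b) C b)
  reindex : ∀ {k} → k ≤ a → f (a ∸ k) ≡ + (a C k) * (sgn k * + ((k +ℕ (n ∸ a +ℕ b)) C b))
  reindex {k} k≤a = begin
    coeffPow a (a ∸ k) * + ((n ∸ (a ∸ k) +ℕ b) C b)
      ≡⟨ cong₂ (λ c m → c * + (m C b)) (coeffPow-reverse k≤a)
               (trans (cong (_+ℕ b) (m∸[n∸o]≡m∸n+o k≤a a≤n)) (ℕ+.xy∙z≈y∙xz (n ∸ a) k b)) ⟩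
    sgn k * + (a C k) * + ((k +ℕ (n ∸ a +ℕ b)) C b)
      ≡⟨ ℤ*.xy∙z≈y∙xz (sgn k) _ _ ⟩
    + (a C k) * (sgn k * + ((k +ℕ (n ∸ a +ℕ b)) C b)) ∎

sumTo-sumTo-coeffPow : ∀ n a b → a ≤ n →
  sumTo n (λ i → sumTo (n ∸ i) (λ j → sgn j * + ((n ∸ i) C j) * (coeffPow a i * coeffPow b j)))
    ≡ sgn a * sgn b * + ((n ∸ a +ℕ b) C n)
sumTo-sumTo-coeffPow n a b a≤n = begin
  sumTo n (λ i → sumTo (n ∸ i) (λ j → sgn j * + ((n ∸ i) C j) * (coeffPow a i * coeffPow b j)))
    ≡⟨ sumTo-cong n (λ {i} _ → inner i) ⟩
  sumTo n (λ i → sgn b * (coeffPow a i * + ((n ∸ i +ℕ b) C b)))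
    ≡⟨ *-distribˡ-sumTo n (sgn b) _ ⟨
  sgn b * sumTo n (λ i → coeffPow a i * + ((n ∸ i +ℕ b) C b))
    ≡⟨ cong (_*_ (sgn b)) (sumTo-coeffPow-binomial n a b a≤n) ⟩
  sgn b * (sgn a * + ((n ∸ a +ℕ b) C n))
    ≡⟨ ℤ*.x∙yz≈yx∙z (sgn b) (sgn a) _ ⟩
  sgn a * sgn b * + ((n ∸ a +ℕ b) C n) ∎
  where
  inner : ∀ i → sumTo (n ∸ i) (λ j → sgn j * + ((n ∸ i) C j) * (coeffPow a i * coeffPow b j))
                ≡ sgn b * (coeffPow a i * + ((n ∸ i +ℕ b) C b))
  inner i = begin
    sumTo (n ∸ i) (λ j → sgn j * + ((n ∸ i) C j) * (coeffPow a i * coeffPow b j))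
      ≡⟨ sumTo-cong (n ∸ i) (λ {j} _ → ℤ*.x∙yz≈y∙xz (sgn j * + ((n ∸ i) C j)) (coeffPow a i) _) ⟩
    sumTo (n ∸ i) (λ j → coeffPow a i * (sgn j * + ((n ∸ i) C j) * coeffPow b j))
      ≡⟨ *-distribˡ-sumTo (n ∸ i) (coeffPow a i) _ ⟨
    coeffPow a i * sumTo (n ∸ i) (λ j → sgn j * + ((n ∸ i) C j) * coeffPow b j)
      ≡⟨ cong (_*_ (coeffPow a i)) (sumTo-alternating-coeffPow (n ∸ i) b) ⟩
    coeffPow a i * (sgn b * + ((n ∸ i +ℕ b) C b))
      ≡⟨ ℤ*.x∙yz≈y∙xz (coeffPow a i) (sgn b) _ ⟩
    sgn b * (coeffPow a i * + ((n ∸ i +ℕ b) C b)) ∎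

sumTo-alternating-binomial-diagonal : ∀ n r → r ≤ n →
  sumTo n (λ t → + (n C t) * (sgn r * sgn t * + ((n ∸ r +ℕ t) C n))) ≡ sgn (n ∸ r)
sumTo-alternating-binomial-diagonal n r r≤n = begin
  sumTo n (λ t → + (n C t) * (sgn r * sgn t * + ((n ∸ r +ℕ t) C n)))
    ≡⟨ sumTo-cong n (λ {t} _ → term t) ⟩
  sumTo n (λ t → sgn r * (+ (n C t) * (sgn t * + ((t +ℕ (n ∸ r)) C n))))
    ≡⟨ *-distribˡ-sumTo n (sgn r) _ ⟨
  sgn r * sumTo n (λ t → + (n C t) * (sgn t * + ((t +ℕ (n ∸ r)) C n)))
    ≡⟨ cong (_*_ (sgn r)) (sumTo-alternating-binomial n (n ∸ r) n (n ∸ r) (ℕ.+-comm (n ∸ r) n)) ⟩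
  sgn r * (sgn n * + ((n ∸ r) C (n ∸ r)))
    ≡⟨ cong (λ c → sgn r * (sgn n * + c)) (nCn≡1 (n ∸ r)) ⟩
  sgn r * (sgn n * + 1)
    ≡⟨ cong (_*_ (sgn r)) (ℤ.*-identityʳ (sgn n)) ⟩
  sgn r * sgn n
    ≡⟨ sgn-∸ r≤n ⟨
  sgn (n ∸ r) ∎
  where
  term : ∀ t → + (n C t) * (sgn r * sgn t * + ((n ∸ r +ℕ t) C n))
               ≡ sgn r * (+ (n C t) * (sgn t * + ((t +ℕ (n ∸ r)) C n)))
  term t = begin
    + (n C t) * (sgn r * sgn t * + ((n ∸ r +ℕ t) C n))
      ≡⟨ cong (λ m → + (n C t) * (sgn r * sgn t * + (m C n))) (ℕ.+-comm (n ∸ r) t) ⟩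
    + (n C t) * (sgn r * sgn t * + ((t +ℕ (n ∸ r)) C n))
      ≡⟨ cong (_*_ (+ (n C t))) (ℤ.*-assoc (sgn r) (sgn t) _) ⟩
    + (n C t) * (sgn r * (sgn t * + ((t +ℕ (n ∸ r)) C n)))
      ≡⟨ ℤ*.x∙yz≈y∙xz (+ (n C t)) (sgn r) _ ⟩
    sgn r * (+ (n C t) * (sgn t * + ((t +ℕ (n ∸ r)) C n))) ∎

sumℤ-allSubsets : ∀ n (h : ℕ → ℤ) →
  sumℤ (map (λ A → h ∣ A ∣) (allSubsets n)) ≡ sumTo n (λ t → + (n C t) * h t)
sumℤ-allSubsets zero    h = trans (ℤ.+-identityʳ (h 0)) (sym (ℤ.*-identityˡ (h 0)))
sumℤ-allSubsets (suc n) h = begin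
  sumℤ (map h∣∣ (map (Vec._∷_ false) L ++ map (Vec._∷_ true) L))
    ≡⟨ cong sumℤ (map-++ h∣∣ (map (Vec._∷_ false) L) (map (Vec._∷_ true) L)) ⟩
  sumℤ (map h∣∣ (map (Vec._∷_ false) L) ++ map h∣∣ (map (Vec._∷_ true) L))
    ≡⟨ sumℤ-++ (map h∣∣ (map (Vec._∷_ false) L)) _ ⟩
  sumℤ (map h∣∣ (map (Vec._∷_ false) L)) + sumℤ (map h∣∣ (map (Vec._∷_ true) L))
    ≡⟨ cong₂ _+_ (cong sumℤ (sym (map-∘ L))) (cong sumℤ (sym (map-∘ L))) ⟩
  sumℤ (map (λ A → h ∣ A ∣) L) + sumℤ (map (λ A → h (suc ∣ A ∣)) L)
    ≡⟨ cong₂ _+_ (sumℤ-allSubsets n h) (sumℤ-allSubsets n (λ t → h (suc t))) ⟩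
  sumTo n (λ t → + (n C t) * h t) + sumTo n (λ t → + (n C t) * h (suc t))
    ≡⟨ sumTo-binomial-suc n h ⟨
  sumTo (suc n) (λ t → + (suc n C t) * h t) ∎
  where
  L : List (Subset n)
  L = allSubsets n
  h∣∣ : Subset (suc n) → ℤ
  h∣∣ A = h ∣ A ∣

tutteTerm : ∀ {n} → Matroid n → Subset n → ℕ → ℕ → ℤ
tutteTerm M A i j = coeffPow (rank M ∸ rk M A) i * coeffPow (∣ A ∣ ∸ rk M A) j

rank≤n : ∀ {n} (M : Matroid n) → rank M ≤ n
rank≤n {n} M = subst (rank M ≤_) (∣⊤∣≡n n) (rk-bound M ⊤)

sumTo-sumTo-tutteTerm : ∀ {n} (M : Matroid n) A →
  sumTo n (λ i → sumTo (n ∸ i) (λ j → sgn j * + ((n ∸ i) C j) * tutteTerm M A i j))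
    ≡ sgn (rank M) * sgn ∣ A ∣ * + ((n ∸ rank M +ℕ ∣ A ∣) C n)
sumTo-sumTo-tutteTerm {n} M A = begin
  sumTo n (λ i → sumTo (n ∸ i) (λ j → sgn j * + ((n ∸ i) C j) * tutteTerm M A i j))
    ≡⟨ sumTo-sumTo-coeffPow n (r ∸ ρ) (∣ A ∣ ∸ ρ) (ℕ.≤-trans (ℕ.m∸n≤m r ρ) r≤n) ⟩
  sgn (r ∸ ρ) * sgn (∣ A ∣ ∸ ρ) * + ((n ∸ (r ∸ ρ) +ℕ (∣ A ∣ ∸ ρ)) C n)
    ≡⟨ cong₂ (λ s m → s * + (m C n)) signs size ⟩
  sgn r * sgn ∣ A ∣ * + ((n ∸ r +ℕ ∣ A ∣) C n) ∎
  where
  r ρ : ℕ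
  r = rank M
  ρ = rk M A
  r≤n : r ≤ n
  r≤n = rank≤n M
  ρ≤r : ρ ≤ r
  ρ≤r = rk-mono M A ⊤ ⊆⊤
  ρ≤∣A∣ : ρ ≤ ∣ A ∣
  ρ≤∣A∣ = rk-bound M A
  signs : sgn (r ∸ ρ) * sgn (∣ A ∣ ∸ ρ) ≡ sgn r * sgn ∣ A ∣
  signs = begin
    sgn (r ∸ ρ) * sgn (∣ A ∣ ∸ ρ)        ≡⟨ cong₂ _*_ (sgn-∸ ρ≤r) (sgn-∸ ρ≤∣A∣) ⟩
    sgn ρ * sgn r * (sgn ρ * sgn ∣ A ∣)  ≡⟨ ℤ*.interchange (sgn ρ) (sgn r) (sgn ρ) (sgn ∣ A ∣) ⟩
    sgn ρ * sgn ρ * (sgn r * sgn ∣ A ∣)  ≡⟨ cong (_* (sgn r * sgn ∣ A ∣)) (sgn-*-sgn ρ) ⟩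
    + 1 * (sgn r * sgn ∣ A ∣)            ≡⟨ ℤ.*-identityˡ (sgn r * sgn ∣ A ∣) ⟩
    sgn r * sgn ∣ A ∣                    ∎
  size : n ∸ (r ∸ ρ) +ℕ (∣ A ∣ ∸ ρ) ≡ n ∸ r +ℕ ∣ A ∣
  size = begin
    n ∸ (r ∸ ρ) +ℕ (∣ A ∣ ∸ ρ)   ≡⟨ cong (_+ℕ (∣ A ∣ ∸ ρ)) (m∸[n∸o]≡m∸n+o ρ≤r r≤n) ⟩
    n ∸ r +ℕ ρ +ℕ (∣ A ∣ ∸ ρ)    ≡⟨ ℕ.+-assoc (n ∸ r) ρ (∣ A ∣ ∸ ρ) ⟩
    n ∸ r +ℕ (ρ +ℕ (∣ A ∣ ∸ ρ))  ≡⟨ cong (n ∸ r +ℕ_) (ℕ.m+[n∸m]≡n ρ≤∣A∣) ⟩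
    n ∸ r +ℕ ∣ A ∣               ∎

corollary5p2 : (n : ℕ) (M : Matroid n) →
    sumTo n (λ i → sumTo (n ∸ i) (λ j →
        sgn j * + ((n ∸ i) C j) * tutteCoeff M i j))
      ≡ sgn (n ∸ rank M)
corollary5p2 n M = begin
  sumTo n (λ i → sumTo (n ∸ i) (λ j → sgn j * + ((n ∸ i) C j) * tutteCoeff M i j))
    ≡⟨ sumTo-sumTo-sumℤ n (n ∸_) (λ i j → sgn j * + ((n ∸ i) C j)) (λ i j A → tutteTerm M A i j)
                        (allSubsets n) ⟩
  sumℤ (map (λ A → sumTo n (λ i → sumTo (n ∸ i) (λ j →
                      sgn j * + ((n ∸ i) C j) * tutteTerm M A i j))) (allSubsets n))
    ≡⟨ cong sumℤ (map-cong (sumTo-sumTo-tutteTerm M) (allSubsets n)) ⟩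
  sumℤ (map (λ A → h ∣ A ∣) (allSubsets n))
    ≡⟨ sumℤ-allSubsets n h ⟩
  sumTo n (λ t → + (n C t) * h t)
    ≡⟨ sumTo-alternating-binomial-diagonal n (rank M) (rank≤n M) ⟩
  sgn (n ∸ rank M) ∎
  where
  h : ℕ → ℤ
  h t = sgn (rank M) * sgn t * + ((n ∸ rank M +ℕ t) C n)
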